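{- Let $G=(V,E)$ be a finite graph. Then $$ \sum_{s}q^{\sum_{v\in V}s(v)}\prod_{\{i,j\}\in E}s(i)s(j)=(q- q^{ -1})^{o(E)}(q+ q^{ -1})^{|V|- o(E)}, $$ where the sum is over all functions $s:V\to\{ -1,1\}$ and $o(E)$ denotes the number of vertices of $G$ of odd degree. -}

module Defs where

open import Level using (Level)
open import Data.Bool using (Bool; true; false; if_then_else_; _∧_)
open import Data.Nat as ℕ using (ℕ; zero; suc; _<ᵇ_)
open import Data.Integer as ℤ using (ℤ; +_; -[1+_])
open import Data.Fin using (Fin; toℕ)
open import Data.Fin.Base using () renaming (zero to fz; suc to fs)
open import Relation.Binary.PropositionalEquality using (_≡_)
open import Algebra.Bundles using (CommutativeRing)

record SimpleGraph (n : ℕ) : Set where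
  field
    adj    : Fin n → Fin n → Bool
    sym    : ∀ i j → adj i j ≡ adj j i
    irrefl : ∀ i → adj i i ≡ false
open SimpleGraph public

countFin : (n : ℕ) → (Fin n → Bool) → ℕ
countFin zero    p = 0
countFin (suc n) p = (if p fz then 1 else 0) ℕ.+ countFin n (λ i → p (fs i))

isOdd : ℕ → Bool
isOdd zero          = false
isOdd (suc zero)    = true
isOdd (suc (suc k)) = isOdd k

degree : ∀ {n} → SimpleGraph n → Fin n → ℕ
degree {n} G i = countFin n (λ j → adj G i j)

oddCount : ∀ {n} → SimpleGraph n → ℕ
oddCount {n} G = countFin n (λ i → isOdd (degree G i))

-- a sign assignment s : V → {-1,1} is encoded as Fin n → Bool (true ↦ 1, false ↦ -1)
signℤ : Bool → ℤ
signℤ true  = + 1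
signℤ false = ℤ.- (+ 1)

sumℤ : (n : ℕ) → (Fin n → ℤ) → ℤ
sumℤ zero    f = + 0
sumℤ (suc n) f = f fz ℤ.+ sumℤ n (λ i → f (fs i))

signSum : ∀ {n} → (Fin n → Bool) → ℤ
signSum {n} s = sumℤ n (λ v → signℤ (s v))

_◂_ : ∀ {n} → Bool → (Fin n → Bool) → Fin (suc n) → Bool
(b ◂ s) fz     = b
(b ◂ s) (fs i) = s i

module Ring {c ℓ} (R : CommutativeRing c ℓ) where
  open CommutativeRing R public

  pow : Carrier → ℕ → Carrier
  pow x zero    = 1#
  pow x (suc k) = x * pow x k

  -- integer power q^k, given q and its inverse qi
  zpow : Carrier → Carrier → ℤ → Carrier
  zpow q qi (+ k)      = pow q k
  zpow q qi -[1+ k ]   = pow qi (suc k)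

  signR : Bool → Carrier
  signR true  = 1#
  signR false = - 1#

  ∑Fin : (n : ℕ) → (Fin n → Carrier) → Carrier
  ∑Fin zero    f = 0#
  ∑Fin (suc n) f = f fz + ∑Fin n (λ i → f (fs i))

  ∏Fin : (n : ℕ) → (Fin n → Carrier) → Carrier
  ∏Fin zero    f = 1#
  ∏Fin (suc n) f = f fz * ∏Fin n (λ i → f (fs i))

  ∑Signs : (n : ℕ) → ((Fin n → Bool) → Carrier) → Carrier
  ∑Signs zero    F = F (λ ())
  ∑Signs (suc n) F = ∑Signs n (λ s → F (true ◂ s)) + ∑Signs n (λ s → F (false ◂ s))

  -- ∏_{{i,j} ∈ E} s(i) s(j): each edge counted once, as the pair i < j
  edgeProd : ∀ {n} → SimpleGraph n → (Fin n → Bool) → Carrier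
  edgeProd {n} G s =
    ∏Fin n (λ i → ∏Fin n (λ j →
      if (toℕ i <ᵇ toℕ j) ∧ adj G i j then signR (s i) * signR (s j) else 1#))

{-# OPTIONS --safe #-}
module Submission where

-- Since s(v) = ±1, q^{∑ s(v)} = ∏_v q^{s(v)}, and grouping the edge product by
-- endpoints gives ∏_{{i,j} ∈ E} s(i) s(j) = ∏_v s(v)^{deg v}.  The summand is
-- therefore a product of independent vertex factors q^{s(v)} s(v)^{deg v}, and
-- the sum over all s factorises as ∏_v (q + (-1)^{deg v} q⁻¹): a factor q - q⁻¹
-- at each odd-degree vertex and q + q⁻¹ at every other one.

open import Defs hiding (sym)
open import Algebra.Bundles using (CommutativeRing; CommutativeMonoid)
open import Data.Bool using (Bool; true; false; if_then_else_; _∧_)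
open import Data.Nat using (ℕ; zero; suc; _∸_; _<ᵇ_; _≤_; _<_; z≤n; s≤s)
import Data.Nat.Properties as ℕ
open import Data.Integer as ℤ using (+_; -[1+_])
open import Data.Fin using (Fin; toℕ)
open import Data.Fin.Base using () renaming (zero to fz; suc to fs)
import Data.Fin.Properties as Fin
open import Function using (_∘_)
open import Relation.Binary.Definitions using (tri<; tri≈; tri>)
open import Relation.Nullary.Negation using (¬_)
open import Relation.Nullary.Reflects using (ofʸ; ofⁿ; det)
import Relation.Binary.PropositionalEquality as ≡

<ᵇ-true : ∀ {m n} → m < n → (m <ᵇ n) ≡.≡ true
<ᵇ-true {m} {n} m<n = det (ℕ.<ᵇ-reflects-< m n) (ofʸ m<n)

<ᵇ-false : ∀ {m n} → ¬ m < n → (m <ᵇ n) ≡.≡ false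
<ᵇ-false {m} {n} m≮n = det (ℕ.<ᵇ-reflects-< m n) (ofⁿ m≮n)

countFin≤ : ∀ n (p : Fin n → Bool) → countFin n p ≤ n
countFin≤ zero    p = z≤n
countFin≤ (suc n) p with p fz
... | true  = s≤s (countFin≤ n (p ∘ fs))
... | false = ℕ.m≤n⇒m≤1+n (countFin≤ n (p ∘ fs))

ascendingEdge : ∀ {n} → SimpleGraph n → Fin n → Fin n → Bool
ascendingEdge G i j = (toℕ i <ᵇ toℕ j) ∧ adj G i j

module FiniteSums {a ℓ} (M : CommutativeMonoid a ℓ) where
  open CommutativeMonoid M renaming
    (_∙_ to _+_; ε to 0#; ∙-congˡ to +-congˡ;
     identityˡ to +-identityˡ; identityʳ to +-identityʳ; assoc to +-assoc)
  open import Algebra.Properties.CommutativeMonoid.Sum M public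
    using (sum; sum-syntax; sum-cong-≋; sum-cong-≗; ∑-distrib-+; ∑-comm)
  open import Algebra.Properties.Monoid.Mult monoid public using (_×_)
  open import Algebra.Properties.CommutativeSemigroup commutativeSemigroup using (x∙yz≈y∙xz)
  open import Relation.Binary.Reasoning.Setoid setoid

  sum-if : ∀ n (p : Fin n → Bool) x → sum (λ j → if p j then x else 0#) ≈ countFin n p × x
  sum-if zero    p x = refl
  sum-if (suc n) p x with p fz
  ... | true  = +-congˡ (sum-if n (p ∘ fs) x)
  ... | false = trans (+-identityˡ _) (sum-if n (p ∘ fs) x)

  sum-if-else : ∀ n (p : Fin n → Bool) x y →
    sum (λ j → if p j then x else y) ≈ countFin n p × x + (n ∸ countFin n p) × y
  sum-if-else zero    p x y = sym (+-identityˡ 0#)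
  sum-if-else (suc n) p x y with p fz | countFin≤ n (p ∘ fs)
  ... | true  | _ = trans (+-congˡ (sum-if-else n (p ∘ fs) x y)) (sym (+-assoc _ _ _))
  ... | false | c≤n rewrite ℕ.+-∸-assoc 1 c≤n =
    trans (+-congˡ (sum-if-else n (p ∘ fs) x y)) (x∙yz≈y∙xz _ _ _)

  if-distrib-+ : ∀ b x y → (if b then x + y else 0#) ≈ (if b then x else 0#) + (if b then y else 0#)
  if-distrib-+ true  x y = refl
  if-distrib-+ false x y = sym (+-identityˡ 0#)

  ascendingEdge-+ : ∀ {n} (G : SimpleGraph n) i j x →
    (if ascendingEdge G i j then x else 0#) + (if ascendingEdge G j i then x else 0#)
      ≈ (if adj G i j then x else 0#)
  ascendingEdge-+ G i j x rewrite SimpleGraph.sym G j i with Fin.<-cmp i j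
  ... | tri< i<j _ j≮i rewrite <ᵇ-true i<j | <ᵇ-false j≮i = +-identityʳ _
  ... | tri> i≮j _ j<i rewrite <ᵇ-false i≮j | <ᵇ-true j<i = +-identityˡ _
  ... | tri≈ i≮i ≡.refl _ rewrite <ᵇ-false i≮i | SimpleGraph.irrefl G i = +-identityˡ 0#

  weighted-handshake : ∀ {n} (G : SimpleGraph n) (σ : Fin n → Carrier) →
    ∑[ i < n ] ∑[ j < n ] (if ascendingEdge G i j then σ i + σ j else 0#)
      ≈ ∑[ v < n ] (degree G v × σ v)
  weighted-handshake {n} G σ = begin
    ∑[ i < n ] ∑[ j < n ] (if e i j then σ i + σ j else 0#)
      ≈⟨ sum-cong-≋ (λ i → sum-cong-≋ (λ j → if-distrib-+ (e i j) (σ i) (σ j))) ⟩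
    ∑[ i < n ] ∑[ j < n ] (atSource i j + atTarget i j)
      ≈⟨ sum-cong-≋ (λ i → ∑-distrib-+ (atSource i) (atTarget i)) ⟩
    ∑[ i < n ] (∑[ j < n ] atSource i j + ∑[ j < n ] atTarget i j)
      ≈⟨ ∑-distrib-+ (λ i → sum (atSource i)) (λ i → sum (atTarget i)) ⟩
    ∑[ i < n ] ∑[ j < n ] atSource i j + ∑[ i < n ] ∑[ j < n ] atTarget i j
      ≈⟨ +-congˡ (∑-comm atTarget) ⟩
    ∑[ i < n ] ∑[ j < n ] atSource i j + ∑[ i < n ] ∑[ j < n ] atTarget j i
      ≈⟨ ∑-distrib-+ (λ i → sum (atSource i)) (λ i → sum (λ j → atTarget j i)) ⟨
    ∑[ i < n ] (∑[ j < n ] atSource i j + ∑[ j < n ] atTarget j i)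
      ≈⟨ sum-cong-≋ (λ i → ∑-distrib-+ (atSource i) (λ j → atTarget j i)) ⟨
    ∑[ i < n ] ∑[ j < n ] (atSource i j + atTarget j i)
      ≈⟨ sum-cong-≋ (λ i → sum-cong-≋ (λ j → ascendingEdge-+ G i j (σ i))) ⟩
    ∑[ i < n ] ∑[ j < n ] (if adj G i j then σ i else 0#)
      ≈⟨ sum-cong-≋ (λ i → sum-if n (adj G i) (σ i)) ⟩
    ∑[ v < n ] (degree G v × σ v) ∎
    where
    e : Fin n → Fin n → Bool
    e = ascendingEdge G
    atSource atTarget : Fin n → Fin n → Carrier
    atSource i j = if e i j then σ i else 0#
    atTarget i j = if e i j then σ j else 0#

module SignSums {c ℓ} (R : CommutativeRing c ℓ) where
  open Defs.Ring R
  open import Algebra.Properties.Ring ring using (-1*x≈-x; -‿involutive)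
  open FiniteSums *-commutativeMonoid using (_×_; sum-cong-≗; weighted-handshake)
    renaming (sum to ∏; sum-cong-≋ to ∏-cong; ∑-distrib-+ to ∏-distrib-*; sum-if-else to ∏-if-else)
  open import Relation.Binary.Reasoning.Setoid setoid

  ∏Fin≡∏ : ∀ n (f : Fin n → Carrier) → ∏Fin n f ≡.≡ ∏ f
  ∏Fin≡∏ zero    f = ≡.refl
  ∏Fin≡∏ (suc n) f = ≡.cong (f fz *_) (∏Fin≡∏ n (f ∘ fs))

  pow≡× : ∀ x k → pow x k ≡.≡ k × x
  pow≡× x zero    = ≡.refl
  pow≡× x (suc k) = ≡.cong (x *_) (pow≡× x k)

  ∏Fin-cong : ∀ n {f g : Fin n → Carrier} → (∀ i → f i ≈ g i) → ∏Fin n f ≈ ∏Fin n g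
  ∏Fin-cong n {f} {g} f≈g rewrite ∏Fin≡∏ n f | ∏Fin≡∏ n g = ∏-cong f≈g

  ∏Fin-distrib-* : ∀ n (f g : Fin n → Carrier) →
    ∏Fin n (λ i → f i * g i) ≈ ∏Fin n f * ∏Fin n g
  ∏Fin-distrib-* n f g
    rewrite ∏Fin≡∏ n (λ i → f i * g i) | ∏Fin≡∏ n f | ∏Fin≡∏ n g = ∏-distrib-* f g

  ∏Fin-if-else : ∀ n (p : Fin n → Bool) x y →
    ∏Fin n (λ j → if p j then x else y) ≈ pow x (countFin n p) * pow y (n ∸ countFin n p)
  ∏Fin-if-else n p x y
    rewrite ∏Fin≡∏ n (λ j → if p j then x else y)
          | pow≡× x (countFin n p) | pow≡× y (n ∸ countFin n p) = ∏-if-else n p x y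

  edgeProd≈∏Fin-pow-degree : ∀ {n} (G : SimpleGraph n) s →
    edgeProd G s ≈ ∏Fin n (λ v → pow (signR (s v)) (degree G v))
  edgeProd≈∏Fin-pow-degree {n} G s = begin
    edgeProd G s
      ≡⟨ ≡.trans (∏Fin≡∏ n _) (sum-cong-≗ (λ i → ∏Fin≡∏ n (edge i))) ⟩
    ∏ (λ i → ∏ (edge i))
      ≈⟨ weighted-handshake G σ ⟩
    ∏ (λ v → degree G v × σ v)
      ≡⟨ ≡.trans (∏Fin≡∏ n _) (sum-cong-≗ (λ v → pow≡× (σ v) (degree G v))) ⟨
    ∏Fin n (λ v → pow (σ v) (degree G v)) ∎
    where
    σ : Fin n → Carrier
    σ = signR ∘ s
    edge : Fin n → Fin n → Carrier
    edge i j = if ascendingEdge G i j then σ i * σ j else 1#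

  pow-1# : ∀ k → pow 1# k ≈ 1#
  pow-1# zero    = refl
  pow-1# (suc k) = trans (*-identityˡ _) (pow-1# k)

  pow-‿1# : ∀ k → pow (- 1#) k ≈ (if isOdd k then - 1# else 1#)
  pow-‿1# zero          = refl
  pow-‿1# (suc zero)    = *-identityʳ _
  pow-‿1# (suc (suc k)) = begin
    - 1# * (- 1# * pow (- 1#) k) ≈⟨ -1*x≈-x _ ⟩
    - (- 1# * pow (- 1#) k)      ≈⟨ -‿cong (-1*x≈-x _) ⟩
    - - pow (- 1#) k             ≈⟨ -‿involutive _ ⟩
    pow (- 1#) k                 ≈⟨ pow-‿1# k ⟩
    (if isOdd k then - 1# else 1#) ∎

  signR-powers-+ : ∀ x y k →
    x * pow (signR true) k + y * pow (signR false) k ≈ (if isOdd k then x - y else x + y)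
  signR-powers-+ x y k =
    trans (+-cong (*-congˡ (pow-1# k)) (*-congˡ (pow-‿1# k))) (by-parity (isOdd k))
    where
    by-parity : ∀ b → x * 1# + y * (if b then - 1# else 1#) ≈ (if b then x - y else x + y)
    by-parity true  = +-cong (*-identityʳ x) (trans (*-comm y (- 1#)) (-1*x≈-x y))
    by-parity false = +-cong (*-identityʳ x) (*-identityʳ y)

  ∑Signs-cong : ∀ n {F H : (Fin n → Bool) → Carrier} →
    (∀ s → F s ≈ H s) → ∑Signs n F ≈ ∑Signs n H
  ∑Signs-cong zero    F≈H = F≈H _
  ∑Signs-cong (suc n) F≈H =
    +-cong (∑Signs-cong n (F≈H ∘ (true ◂_))) (∑Signs-cong n (F≈H ∘ (false ◂_)))

  *-distribˡ-∑Signs : ∀ n x (F : (Fin n → Bool) → Carrier) →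
    x * ∑Signs n F ≈ ∑Signs n (λ s → x * F s)
  *-distribˡ-∑Signs zero    x F = refl
  *-distribˡ-∑Signs (suc n) x F =
    trans (distribˡ x _ _) (+-cong (*-distribˡ-∑Signs n x _) (*-distribˡ-∑Signs n x _))

  ∑Signs-∏Fin : ∀ n (g : Bool → Fin n → Carrier) →
    ∑Signs n (λ s → ∏Fin n (λ v → g (s v) v)) ≈ ∏Fin n (λ v → g true v + g false v)
  ∑Signs-∏Fin zero    g = refl
  ∑Signs-∏Fin (suc n) g = begin
    ∑Signs n (λ s → g true fz * P s) + ∑Signs n (λ s → g false fz * P s)
      ≈⟨ +-cong (*-distribˡ-∑Signs n _ P) (*-distribˡ-∑Signs n _ P) ⟨
    g true fz * ∑Signs n P + g false fz * ∑Signs n P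
      ≈⟨ distribʳ _ _ _ ⟨
    (g true fz + g false fz) * ∑Signs n P
      ≈⟨ *-congˡ (∑Signs-∏Fin n (λ b v → g b (fs v))) ⟩
    (g true fz + g false fz) * ∏Fin n (λ v → g true (fs v) + g false (fs v)) ∎
    where
    P : (Fin n → Bool) → Carrier
    P s = ∏Fin n (λ v → g (s v) (fs v))

  module _ {q qi : Carrier} (q*qi≈1 : q * qi ≈ 1#) where
    q*[qi*x]≈x : ∀ x → q * (qi * x) ≈ x
    q*[qi*x]≈x x = trans (sym (*-assoc q qi x)) (trans (*-congʳ q*qi≈1) (*-identityˡ x))

    qi*[q*x]≈x : ∀ x → qi * (q * x) ≈ x
    qi*[q*x]≈x x =
      trans (sym (*-assoc qi q x)) (trans (*-congʳ (trans (*-comm qi q) q*qi≈1)) (*-identityˡ x))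

    zpow-signℤ-+ : ∀ b z → zpow q qi (signℤ b ℤ.+ z) ≈ (if b then q else qi) * zpow q qi z
    zpow-signℤ-+ true  (+ k)        = refl
    zpow-signℤ-+ true  -[1+ zero ]  = sym (q*[qi*x]≈x 1#)
    zpow-signℤ-+ true  -[1+ suc k ] = sym (q*[qi*x]≈x _)
    zpow-signℤ-+ false (+ zero)     = refl
    zpow-signℤ-+ false (+ suc k)    = sym (qi*[q*x]≈x _)
    zpow-signℤ-+ false -[1+ k ]     = refl

    zpow-signSum : ∀ {n} (s : Fin n → Bool) →
      zpow q qi (signSum s) ≈ ∏Fin n (λ v → if s v then q else qi)
    zpow-signSum {zero}  s = refl
    zpow-signSum {suc n} s = trans (zpow-signℤ-+ (s fz) _) (*-congˡ (zpow-signSum (s ∘ fs)))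

lemma2p3 : ∀ {c ℓ} (R : CommutativeRing c ℓ) → let open Defs.Ring R in
             (n : ℕ) (G : SimpleGraph n) (q qi : Carrier) → q * qi ≈ 1# →
             ∑Signs n (λ s → zpow q qi (signSum s) * edgeProd G s)
               ≈ pow (q - qi) (oddCount G) * pow (q + qi) (n ∸ oddCount G)
lemma2p3 R n G q qi q*qi≈1 = begin
  ∑Signs n (λ s → zpow q qi (signSum s) * edgeProd G s)
    ≈⟨ ∑Signs-cong n summand-factorises ⟩
  ∑Signs n (λ s → ∏Fin n (λ v → vertexFactor (s v) v))
    ≈⟨ ∑Signs-∏Fin n vertexFactor ⟩
  ∏Fin n (λ v → vertexFactor true v + vertexFactor false v)
    ≈⟨ ∏Fin-cong n (λ v → signR-powers-+ q qi (degree G v)) ⟩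
  ∏Fin n (λ v → if isOdd (degree G v) then q - qi else q + qi)
    ≈⟨ ∏Fin-if-else n (isOdd ∘ degree G) (q - qi) (q + qi) ⟩
  pow (q - qi) (oddCount G) * pow (q + qi) (n ∸ oddCount G) ∎
  where
  open Defs.Ring R
  open SignSums R
  open import Relation.Binary.Reasoning.Setoid setoid

  vertexFactor : Bool → Fin n → Carrier
  vertexFactor b v = (if b then q else qi) * pow (signR b) (degree G v)

  summand-factorises : ∀ s →
    zpow q qi (signSum s) * edgeProd G s ≈ ∏Fin n (λ v → vertexFactor (s v) v)
  summand-factorises s =
    trans (*-cong (zpow-signSum q*qi≈1 s) (edgeProd≈∏Fin-pow-degree G s))
          (sym (∏Fin-distrib-* n _ _))
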